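{- For all positive integers $n$ and $s$, $$\sum_{\substack{a=1\\ (a,n^s)_s=1}}^{n^s} (a-1,n^s)_s=\Phi_s(n^s)\,\tau_s(n^s).$$
   Context: For a positive integer $s$ and integers $a,b$ not both zero, $(a,b)_s$ (the generalized gcd) denotes the largest $l^s$ with $l\in\mathbb{N}$ such that $l^s$ divides both $a$ and $b$; in particular $(0,b)_s$ is the largest $s$-th power dividing $b$. For positive integers $s,m$, Klee's function $\Phi_s(m)$ is the number of integers $k$ with $1\le k\le m$ and $(k,m)_s=1$. For a positive integer $m$, $\tau_s(m)$ denotes the number of positive integers $d$ such that $d^s$ divides $m$. -}

module Defs where

open import Data.Nat using (ℕ; zero; suc; _+_; _*_; _∸_; _^_; _⊔_)
open import Data.Nat.Divisibility using (_∣_; _∣?_)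
open import Data.List using (List; map; filter; length; upTo; applyUpTo)
open import Data.Nat.ListAction using (sum)
open import Data.Product using (_×_)
open import Relation.Nullary.Decidable using (_×-dec_)

range1 : ℕ → List ℕ
range1 m = applyUpTo suc m

-- Candidates l ∈ [1 .. a + b] with l ^ s ∣ a and l ^ s ∣ b.
-- For s ≥ 1 and (a , b) ≠ (0 , 0), any l with l ^ s dividing a nonzero one
-- of a , b satisfies l ≤ a + b, so this search is exhaustive.
commonPowDivs : ℕ → ℕ → ℕ → List ℕ
commonPowDivs s a b =
  filter (λ l → ((l ^ s) ∣? a) ×-dec ((l ^ s) ∣? b)) (range1 (a + b))

maxList : List ℕ → ℕ
maxList = Data.List.foldr _⊔_ 0

gcdₛ : ℕ → ℕ → ℕ → ℕ
gcdₛ s a b = maxList (map (λ l → l ^ s) (commonPowDivs s a b))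

Φ : ℕ → ℕ → ℕ
Φ s m = length (filter (λ k → gcdₛ s k m Data.Nat.≟ 1) (range1 m))

-- τ_s(m) = #{ d ≥ 1 : d ^ s ∣ m }  (for m ≥ 1, s ≥ 1 such d satisfy d ≤ m)
τ : ℕ → ℕ → ℕ
τ s m = length (filter (λ d → (d ^ s) ∣? m) (range1 m))

lhsSum : ℕ → ℕ → ℕ
lhsSum n s =
  sum (map (λ a → gcdₛ s (a ∸ 1) (n ^ s))
           (filter (λ a → gcdₛ s a (n ^ s) Data.Nat.≟ 1) (range1 (n ^ s))))

-- Write (x , n ^ s)ₛ as D ^ s, D the largest divisor of n with D ^ s ∣ x.  The Gauss-type
-- identity D ^ s = Σ_{d ∣ D} Φ_s(d ^ s) turns the left-hand side into
-- Σ_{d ∣ n} Φ_s(d ^ s) · #{a ≤ n ^ s : (a , n ^ s)ₛ = 1, a ≡ 1 (mod d ^ s)}.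
-- Each count equals Φ_s(n ^ s) / Φ_s(d ^ s): if n' is the largest divisor of n coprime to d,
-- then (a , n ^ s)ₛ = 1 iff (a , d ^ s)ₛ = 1 and (a , n' ^ s)ₛ = 1, and since d ^ s is
-- invertible modulo n' ^ s the second condition is equidistributed over the residue classes
-- modulo d ^ s.  Finally the d ∣ n are exactly the d with d ^ s ∣ n ^ s, so there are
-- τ_s(n ^ s) of them.

module Submission where

open import Defs
open import Data.Nat
open import Data.Nat.Properties
open import Data.Nat.Divisibility
open import Data.Nat.DivMod using (m/n*n≡m)
open import Data.Nat.GCD
open import Data.Nat.LCM
open import Data.Nat.Coprimality
  using (Coprime; coprime-divisor; coprime-/gcd; coprime⇒gcd≡1; gcd≡1⇒coprime; coprime-Bézout)
  renaming (sym to coprime-sym)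
open import Data.Nat.Tactic.RingSolver using (solve-∀)
open import Algebra.Properties.CommutativeSemigroup +-commutativeSemigroup
  using () renaming (interchange to +-interchange)
open import Data.List using ([]; _∷_; map; filter; length; applyUpTo)
open import Data.Nat.ListAction using (sum)
open import Data.List.Membership.Propositional using (_∈_)
open import Data.List.Membership.Propositional.Properties
  using (∈-map⁺; ∈-map⁻; ∈-filter⁺; ∈-filter⁻; ∈-applyUpTo⁺)
open import Data.List.Relation.Unary.Any using (here; there)
open import Data.Product using (_×_; _,_; proj₁; proj₂)
open import Data.Sum using (_⊎_; inj₁; inj₂; [_,_])
open import Data.Empty using (⊥-elim)
open import Relation.Nullary using (Dec; yes; no; ¬_)
open import Relation.Nullary.Decidable using (_×-dec_)
open import Relation.Unary using (Decidable)
open import Relation.Binary.PropositionalEquality hiding ([_])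

∑< : ℕ → (ℕ → ℕ) → ℕ
∑< zero    f = 0
∑< (suc k) f = f 0 + ∑< k (λ i → f (suc i))

syntax ∑< k (λ i → e) = ∑[ i < k ] e

∑-cong : ∀ k {f g : ℕ → ℕ} → (∀ i → i < k → f i ≡ g i) → ∑< k f ≡ ∑< k g
∑-cong zero    f≗g = refl
∑-cong (suc k) f≗g = cong₂ _+_ (f≗g 0 z<s) (∑-cong k (λ i i<k → f≗g (suc i) (s<s i<k)))

∑-zero : ∀ k {f : ℕ → ℕ} → (∀ i → i < k → f i ≡ 0) → ∑< k f ≡ 0
∑-zero zero    f≗0 = refl
∑-zero (suc k) f≗0 = cong₂ _+_ (f≗0 0 z<s) (∑-zero k (λ i i<k → f≗0 (suc i) (s<s i<k)))

∑-const : ∀ k c → ∑[ _ < k ] c ≡ k * c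
∑-const zero    c = refl
∑-const (suc k) c = cong (c +_) (∑-const k c)

∑-distrib-+ : ∀ k (f g : ℕ → ℕ) → ∑[ i < k ] (f i + g i) ≡ ∑< k f + ∑< k g
∑-distrib-+ zero    f g = refl
∑-distrib-+ (suc k) f g = begin
  (f 0 + g 0) + ∑[ i < k ] (f (suc i) + g (suc i))
    ≡⟨ cong ((f 0 + g 0) +_) (∑-distrib-+ k _ _) ⟩
  (f 0 + g 0) + ((∑[ i < k ] f (suc i)) + (∑[ i < k ] g (suc i)))
    ≡⟨ +-interchange (f 0) (g 0) _ _ ⟩
  (f 0 + ∑[ i < k ] f (suc i)) + (g 0 + ∑[ i < k ] g (suc i)) ∎
  where open ≡-Reasoning

*-distribˡ-∑ : ∀ k c (f : ℕ → ℕ) → c * ∑< k f ≡ ∑[ i < k ] (c * f i)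
*-distribˡ-∑ zero    c f = *-zeroʳ c
*-distribˡ-∑ (suc k) c f =
  trans (*-distribˡ-+ c (f 0) _) (cong (c * f 0 +_) (*-distribˡ-∑ k c (λ i → f (suc i))))

*-distribʳ-∑ : ∀ k c (f : ℕ → ℕ) → ∑< k f * c ≡ ∑[ i < k ] (f i * c)
*-distribʳ-∑ k c f =
  trans (*-comm _ c) (trans (*-distribˡ-∑ k c f) (∑-cong k (λ i _ → *-comm c (f i))))

∑-comm : ∀ a b (f : ℕ → ℕ → ℕ) → ∑[ i < a ] ∑[ j < b ] f i j ≡ ∑[ j < b ] ∑[ i < a ] f i j
∑-comm zero    b f = sym (∑-zero b (λ _ _ → refl))
∑-comm (suc a) b f = trans (cong ((∑[ j < b ] f 0 j) +_) (∑-comm a b (λ i j → f (suc i) j)))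
                           (sym (∑-distrib-+ b (λ j → f 0 j) (λ j → ∑[ i < a ] f (suc i) j)))

∑-split : ∀ a b (f : ℕ → ℕ) → ∑< (a + b) f ≡ ∑< a f + ∑[ i < b ] f (a + i)
∑-split zero    b f = refl
∑-split (suc a) b f = trans (cong (f 0 +_) (∑-split a b (λ i → f (suc i)))) (sym (+-assoc (f 0) _ _))

∑-last : ∀ k (f : ℕ → ℕ) → ∑< (suc k) f ≡ ∑< k f + f k
∑-last k f = begin
  ∑< (suc k) f                  ≡⟨ cong (λ l → ∑< l f) (+-comm 1 k) ⟩
  ∑< (k + 1) f                  ≡⟨ ∑-split k 1 f ⟩
  ∑< k f + (f (k + 0) + 0)      ≡⟨ cong (∑< k f +_) (trans (+-identityʳ _) (cong f (+-identityʳ k))) ⟩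
  ∑< k f + f k                  ∎
  where open ≡-Reasoning

∑-truncate : ∀ {a b} (f : ℕ → ℕ) → a ≤ b → (∀ j → f (a + j) ≡ 0) → ∑< b f ≡ ∑< a f
∑-truncate {a} {b} f a≤b f≡0 = begin
  ∑< b f                                   ≡⟨ cong (λ k → ∑< k f) (sym (m+[n∸m]≡n a≤b)) ⟩
  ∑< (a + (b ∸ a)) f                       ≡⟨ ∑-split a (b ∸ a) f ⟩
  ∑< a f + ∑[ j < b ∸ a ] f (a + j)        ≡⟨ cong (∑< a f +_) (∑-zero (b ∸ a) (λ j _ → f≡0 j)) ⟩
  ∑< a f + 0                               ≡⟨ +-identityʳ _ ⟩
  ∑< a f                                   ∎
  where open ≡-Reasoning

∑-blocks : ∀ M m (f : ℕ → ℕ) → ∑< (M * m) f ≡ ∑[ t < M ] ∑[ b < m ] f (b + t * m)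
∑-blocks zero    m f = refl
∑-blocks (suc M) m f = begin
  ∑< (m + M * m) f
    ≡⟨ ∑-split m (M * m) f ⟩
  ∑< m f + ∑[ i < M * m ] f (m + i)
    ≡⟨ cong₂ _+_ (∑-cong m (λ b _ → cong f (sym (+-identityʳ b))))
                 (∑-blocks M m (λ i → f (m + i))) ⟩
  (∑[ b < m ] f (b + 0)) + (∑[ t < M ] ∑[ b < m ] f (m + (b + t * m)))
    ≡⟨ cong ((∑[ b < m ] f (b + 0)) +_)
            (∑-cong M (λ t _ → ∑-cong m (λ b _ → cong f (x+[b+y]≡b+[x+y] m b (t * m))))) ⟩
  (∑[ b < m ] f (b + 0)) + (∑[ t < M ] ∑[ b < m ] f (b + suc t * m)) ∎
  where
  open ≡-Reasoning
  x+[b+y]≡b+[x+y] : ∀ x b y → x + (b + y) ≡ b + (x + y)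
  x+[b+y]≡b+[x+y] = solve-∀

∑-rotate : ∀ k (f : ℕ → ℕ) → (∀ i → f (i + k) ≡ f i) → ∀ w → ∑[ i < k ] f (i + w) ≡ ∑< k f
∑-rotate k f periodic zero    = ∑-cong k (λ i _ → cong f (+-identityʳ i))
∑-rotate k f periodic (suc w) = begin
  ∑[ i < k ] f (i + suc w)       ≡⟨ ∑-cong k (λ i _ → cong f (+-suc i w)) ⟩
  ∑[ i < k ] f (suc i + w)       ≡⟨ +-cancelˡ-≡ (f w) _ _ rotate-once ⟩
  ∑[ i < k ] f (i + w)           ≡⟨ ∑-rotate k f periodic w ⟩
  ∑< k f                         ∎
  where
  open ≡-Reasoning
  rotate-once : f w + ∑[ i < k ] f (suc i + w) ≡ f w + ∑[ i < k ] f (i + w)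
  rotate-once = begin
    ∑< (suc k) (λ i → f (i + w))
      ≡⟨ ∑-last k (λ i → f (i + w)) ⟩
    (∑[ i < k ] f (i + w)) + f (k + w)
      ≡⟨ cong ((∑[ i < k ] f (i + w)) +_) (trans (cong f (+-comm k w)) (periodic w)) ⟩
    (∑[ i < k ] f (i + w)) + f w
      ≡⟨ +-comm _ (f w) ⟩
    f w + ∑[ i < k ] f (i + w) ∎

∑-head : ∀ k (f : ℕ → ℕ) → k ≢ 0 → (∀ i → 0 < i → i < k → f i ≡ 0) → ∑< k f ≡ f 0
∑-head zero    f k≢0 _ = ⊥-elim (k≢0 refl)
∑-head (suc k) f _ f≡0 =
  trans (cong (f 0 +_) (∑-zero k (λ i i<k → f≡0 (suc i) z<s (s<s i<k)))) (+-identityʳ (f 0))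

𝟙 : ∀ {a} {A : Set a} → Dec A → ℕ
𝟙 (yes _) = 1
𝟙 (no _)  = 0

𝟙-cong : ∀ {a b} {A : Set a} {B : Set b} → (A → B) → (B → A) →
         (A? : Dec A) (B? : Dec B) → 𝟙 A? ≡ 𝟙 B?
𝟙-cong A→B B→A (yes a) (yes b) = refl
𝟙-cong A→B B→A (yes a) (no ¬b) = ⊥-elim (¬b (A→B a))
𝟙-cong A→B B→A (no ¬a) (yes b) = ⊥-elim (¬a (B→A b))
𝟙-cong A→B B→A (no ¬a) (no ¬b) = refl

𝟙-× : ∀ {a b} {A : Set a} {B : Set b} (A? : Dec A) (B? : Dec B) → 𝟙 (A? ×-dec B?) ≡ 𝟙 A? * 𝟙 B?
𝟙-× (yes a) (yes b) = refl
𝟙-× (yes a) (no ¬b) = refl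
𝟙-× (no ¬a) B?      = refl

𝟙-yes : ∀ {a} {A : Set a} (A? : Dec A) → A → 𝟙 A? ≡ 1
𝟙-yes (yes _) a = refl
𝟙-yes (no ¬a) a = ⊥-elim (¬a a)

𝟙-no : ∀ {a} {A : Set a} (A? : Dec A) → ¬ A → 𝟙 A? ≡ 0
𝟙-no (yes a) ¬a = ⊥-elim (¬a a)
𝟙-no (no _)  ¬a = refl

∑-δ : ∀ {D a} → a < D → ∑[ j < D ] 𝟙 (j ≟ a) ≡ 1
∑-δ {suc D} {zero}  _         = cong suc (∑-zero D (λ i _ → 𝟙-no (suc i ≟ 0) (λ ())))
∑-δ {suc D} {suc a} (s<s a<D) =
  trans (∑-cong D (λ j _ → 𝟙-cong (cong pred) (cong suc) (suc j ≟ suc a) (j ≟ a))) (∑-δ a<D)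

length-filter-applyUpTo : ∀ {p} {P : ℕ → Set p} (P? : Decidable P) (f : ℕ → ℕ) k →
  length (filter P? (applyUpTo f k)) ≡ ∑[ i < k ] 𝟙 (P? (f i))
length-filter-applyUpTo P? f zero    = refl
length-filter-applyUpTo P? f (suc k) with P? (f 0)
... | yes _ = cong suc (length-filter-applyUpTo P? (λ i → f (suc i)) k)
... | no _  = length-filter-applyUpTo P? (λ i → f (suc i)) k

sum-map-filter-applyUpTo : ∀ {p} {P : ℕ → Set p} (P? : Decidable P) (g f : ℕ → ℕ) k →
  sum (map g (filter P? (applyUpTo f k))) ≡ ∑[ i < k ] (𝟙 (P? (f i)) * g (f i))
sum-map-filter-applyUpTo P? g f zero    = refl
sum-map-filter-applyUpTo P? g f (suc k) with P? (f 0)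
... | yes _ = cong₂ _+_ (sym (+-identityʳ (g (f 0)))) (sum-map-filter-applyUpTo P? g (λ i → f (suc i)) k)
... | no _  = sum-map-filter-applyUpTo P? g (λ i → f (suc i)) k

^-distribʳ-* : ∀ s m n → (m * n) ^ s ≡ m ^ s * n ^ s
^-distribʳ-* zero    m n = refl
^-distribʳ-* (suc s) m n =
  trans (cong (m * n *_) (^-distribʳ-* s m n)) (middle-swap m n (m ^ s) (n ^ s))
  where
  middle-swap : ∀ a b x y → a * b * (x * y) ≡ a * x * (b * y)
  middle-swap = solve-∀

^-monoˡ-∣ : ∀ s {m n} → m ∣ n → m ^ s ∣ n ^ s
^-monoˡ-∣ zero    m∣n = ∣-refl
^-monoˡ-∣ (suc s) m∣n = *-pres-∣ m∣n (^-monoˡ-∣ s m∣n)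

∣-≢0 : ∀ {d n} → d ∣ n → n ≢ 0 → d ≢ 0
∣-≢0 d∣n n≢0 d≡0 = n≢0 (0∣⇒≡0 (subst (_∣ _) d≡0 d∣n))

∤-progression : ∀ {m b} t → 0 < b → b < m → m ∤ b + t * m
∤-progression {m} {b} t 0<b b<m m∣b+tm =
  <⇒≱ b<m (∣⇒≤ {{>-nonZero 0<b}} (∣m+n∣m⇒∣n (subst (m ∣_) (+-comm b (t * m)) m∣b+tm) (n∣m*n t)))

^-cancelˡ-≤ : ∀ {s m n} → s ≢ 0 → m ^ s ≤ n ^ s → m ≤ n
^-cancelˡ-≤ {s} {m} {n} s≢0 mˢ≤nˢ with m ≤? n
... | yes m≤n = m≤n
... | no m≰n  = ⊥-elim (<⇒≱ (^-monoˡ-< s {{≢-nonZero s≢0}} (≰⇒> m≰n)) mˢ≤nˢ)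

^-cancelˡ-≡ : ∀ {s m n} → s ≢ 0 → m ^ s ≡ n ^ s → m ≡ n
^-cancelˡ-≡ s≢0 eq =
  ≤-antisym (^-cancelˡ-≤ s≢0 (≤-reflexive eq)) (^-cancelˡ-≤ s≢0 (≤-reflexive (sym eq)))

m≤m^n : ∀ m {n} → n ≢ 0 → m ≤ m ^ n
m≤m^n zero              _   = z≤n
m≤m^n (suc _)   {zero}  n≢0 = ⊥-elim (n≢0 refl)
m≤m^n m@(suc _) {suc n} _   = m≤m*n m (m ^ n) {{m^n≢0 m n}}

1+m+n∤m : ∀ {m} n → m ≢ 0 → suc (m + n) ∤ m
1+m+n∤m {m} n m≢0 ∣m = <⇒≱ (s≤s (m≤m+n m n)) (∣⇒≤ {{≢-nonZero m≢0}} ∣m)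

coprime-*ʳ : ∀ {a b c} → Coprime a b → Coprime a c → Coprime a (b * c)
coprime-*ʳ {a} {b} cop[a,b] cop[a,c] {d} (d∣a , d∣bc) = cop[a,c] (d∣a , coprime-divisor cop[d,b] d∣bc)
  where
  cop[d,b] : Coprime d b
  cop[d,b] (i∣d , i∣b) = cop[a,b] (∣-trans i∣d d∣a , i∣b)

coprime-^ʳ : ∀ {a b} t → Coprime a b → Coprime a (b ^ t)
coprime-^ʳ zero    _   (_ , d∣1) = ∣1⇒≡1 d∣1
coprime-^ʳ (suc t) cop = coprime-*ʳ cop (coprime-^ʳ t cop)

coprime-^ : ∀ {a b} s → Coprime a b → Coprime (a ^ s) (b ^ s)
coprime-^ s cop = coprime-^ʳ s (coprime-sym (coprime-^ʳ s (coprime-sym cop)))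

m∣n⇒gcd[m,n]≡m : ∀ {m n} → m ∣ n → gcd m n ≡ m
m∣n⇒gcd[m,n]≡m {m} {n} m∣n = ∣-antisym (gcd[m,n]∣m m n) (gcd-greatest ∣-refl m∣n)

gcd-^ : ∀ s a b → gcd (a ^ s) (b ^ s) ≡ gcd a b ^ s
gcd-^ s a b with gcd a b ≟ 0
... | yes g≡0 = begin
  gcd (a ^ s) (b ^ s)
    ≡⟨ cong₂ (λ x y → gcd (x ^ s) (y ^ s)) (gcd[m,n]≡0⇒m≡0 g≡0) (gcd[m,n]≡0⇒n≡0 a g≡0) ⟩
  gcd (0 ^ s) (0 ^ s)
    ≡⟨ m∣n⇒gcd[m,n]≡m ∣-refl ⟩
  0 ^ s
    ≡⟨ cong (_^ s) (sym g≡0) ⟩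
  gcd a b ^ s ∎
  where open ≡-Reasoning
... | no g≢0 = begin
  gcd (a ^ s) (b ^ s)
    ≡⟨ cong₂ gcd (scaled (gcd[m,n]∣m a b)) (scaled (gcd[m,n]∣n a b)) ⟩
  gcd (g ^ s * (a / g) ^ s) (g ^ s * (b / g) ^ s)
    ≡⟨ sym (c*gcd[m,n]≡gcd[cm,cn] (g ^ s) _ _) ⟩
  g ^ s * gcd ((a / g) ^ s) ((b / g) ^ s)
    ≡⟨ cong (g ^ s *_) (coprime⇒gcd≡1 (coprime-^ s (coprime-/gcd a b))) ⟩
  g ^ s * 1
    ≡⟨ *-identityʳ _ ⟩
  g ^ s ∎
  where
  open ≡-Reasoning
  g : ℕ
  g = gcd a b
  instance
    g-nonZero : NonZero g
    g-nonZero = ≢-nonZero g≢0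
  scaled : ∀ {x} → g ∣ x → x ^ s ≡ g ^ s * (x / g) ^ s
  scaled {x} g∣x = begin
    x ^ s                ≡⟨ cong (_^ s) (sym (m/n*n≡m g∣x)) ⟩
    (x / g * g) ^ s      ≡⟨ ^-distribʳ-* s (x / g) g ⟩
    (x / g) ^ s * g ^ s  ≡⟨ *-comm ((x / g) ^ s) (g ^ s) ⟩
    g ^ s * (x / g) ^ s  ∎

lcm-^ : ∀ s a b → a ≢ 0 → lcm (a ^ s) (b ^ s) ≡ lcm a b ^ s
lcm-^ s a b a≢0 = *-cancelˡ-≡ _ _ (gcd a b ^ s) {{m^n≢0 (gcd a b) s}} (begin
  gcd a b ^ s * lcm (a ^ s) (b ^ s)          ≡⟨ cong (_* lcm (a ^ s) (b ^ s)) (sym (gcd-^ s a b)) ⟩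
  gcd (a ^ s) (b ^ s) * lcm (a ^ s) (b ^ s)  ≡⟨ gcd*lcm (a ^ s) (b ^ s) ⟩
  a ^ s * b ^ s                              ≡⟨ sym (^-distribʳ-* s a b) ⟩
  (a * b) ^ s                                ≡⟨ cong (_^ s) (sym (gcd*lcm a b)) ⟩
  (gcd a b * lcm a b) ^ s                    ≡⟨ ^-distribʳ-* s (gcd a b) (lcm a b) ⟩
  gcd a b ^ s * lcm a b ^ s                  ∎)
  where
  open ≡-Reasoning
  instance
    g-nonZero : NonZero (gcd a b)
    g-nonZero = ≢-nonZero (gcd[m,n]≢0 a b (inj₁ a≢0))

lcm-^-least : ∀ s {a b x} → a ^ s ∣ x → b ^ s ∣ x → lcm a b ^ s ∣ x
lcm-^-least s {a} {b} {x} aˢ∣x bˢ∣x with a ≟ 0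
... | yes refl = subst (λ l → l ^ s ∣ x) (sym (lcm[0,n]≡0 b)) aˢ∣x
... | no a≢0   = subst (_∣ x) (lcm-^ s a b a≢0) (lcm-least aˢ∣x bˢ∣x)

m^s∣n^s⇒m∣n : ∀ {s m n} → s ≢ 0 → m ^ s ∣ n ^ s → m ∣ n
m^s∣n^s⇒m∣n {s} {m} {n} s≢0 mˢ∣nˢ = subst (_∣ n) gcd≡m (gcd[m,n]∣n m n)
  where
  gcd≡m : gcd m n ≡ m
  gcd≡m = ^-cancelˡ-≡ s≢0 (trans (sym (gcd-^ s m n)) (m∣n⇒gcd[m,n]≡m mˢ∣nˢ))

∈⇒≤maxList : ∀ {y} ys → y ∈ ys → y ≤ maxList ys
∈⇒≤maxList (z ∷ zs) (here refl) = m≤m⊔n z (maxList zs)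
∈⇒≤maxList (z ∷ zs) (there y∈zs) = ≤-trans (∈⇒≤maxList zs y∈zs) (m≤n⊔m z (maxList zs))

maxList≤ : ∀ {v} ys → (∀ {y} → y ∈ ys → y ≤ v) → maxList ys ≤ v
maxList≤ []       _     = z≤n
maxList≤ (z ∷ zs) ys≤v = ⊔-lub (ys≤v (here refl)) (maxList≤ zs (λ y∈zs → ys≤v (there y∈zs)))

maxList∈⊎≡0 : ∀ ys → maxList ys ∈ ys ⊎ maxList ys ≡ 0
maxList∈⊎≡0 []       = inj₂ refl
maxList∈⊎≡0 (z ∷ zs) with maxList∈⊎≡0 zs | ⊔-sel z (maxList zs)
... | _           | inj₁ max≡z    = inj₁ (here max≡z)
... | inj₁ m∈zs   | inj₂ max≡m    = inj₁ (subst (_∈ z ∷ zs) (sym max≡m) (there m∈zs))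
... | inj₂ m≡0    | inj₂ max≡m    = inj₂ (trans max≡m m≡0)

∈-range1 : ∀ {d K} → 1 ≤ d → d ≤ K → d ∈ range1 K
∈-range1 {suc i} _ i<K = ∈-applyUpTo⁺ suc i<K

gcdRoot-candidate? : ∀ s x n → Decidable (λ l → l ∣ n × l ^ s ∣ x)
gcdRoot-candidate? s x n l = (l ∣? n) ×-dec (l ^ s ∣? x)

gcdRoot : ℕ → ℕ → ℕ → ℕ
gcdRoot s x n = maxList (filter (gcdRoot-candidate? s x n) (range1 n))

module GcdRoot (s x n : ℕ) (n≢0 : n ≢ 0) where

  private
    D : ℕ
    D = gcdRoot s x n
    instance
      n-nonZero : NonZero n
      n-nonZero = ≢-nonZero n≢0

  gcdRoot-max : ∀ {l} → l ∣ n → l ^ s ∣ x → l ≤ D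
  gcdRoot-max {zero}  _   _    = z≤n
  gcdRoot-max {suc i} l∣n lˢ∣x =
    ∈⇒≤maxList _ (∈-filter⁺ (gcdRoot-candidate? s x n) (∈-applyUpTo⁺ suc (∣⇒≤ l∣n)) (l∣n , lˢ∣x))

  gcdRoot≢0 : D ≢ 0
  gcdRoot≢0 D≡0 = 1+n≰n (subst (1 ≤_) D≡0 (gcdRoot-max (1∣ n) (subst (_∣ x) (sym (^-zeroˡ s)) (1∣ x))))

  gcdRoot∣ : D ∣ n × D ^ s ∣ x
  gcdRoot∣ with maxList∈⊎≡0 (filter (gcdRoot-candidate? s x n) (range1 n))
  ... | inj₁ D∈  = proj₂ (∈-filter⁻ (gcdRoot-candidate? s x n) {xs = range1 n} D∈)
  ... | inj₂ D≡0 = ⊥-elim (gcdRoot≢0 D≡0)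

  gcdRoot-greatest : ∀ {f} → f ∣ n → f ^ s ∣ x → f ∣ D
  gcdRoot-greatest {f} f∣n fˢ∣x = subst (f ∣_) lcm≡D (m∣lcm[m,n] f D)
    where
    L : ℕ
    L = lcm f D
    L∣n : L ∣ n
    L∣n = lcm-least f∣n (proj₁ gcdRoot∣)
    L≢0 : L ≢ 0
    L≢0 = ∣-≢0 L∣n n≢0
    lcm≡D : L ≡ D
    lcm≡D = ≤-antisym (gcdRoot-max L∣n (lcm-^-least s fˢ∣x (proj₂ gcdRoot∣)))
                      (∣⇒≤ {{≢-nonZero L≢0}} (n∣lcm[m,n] f D))

gcdₛ≡gcdRoot^s : ∀ {s n} x → s ≢ 0 → n ≢ 0 → gcdₛ s x (n ^ s) ≡ gcdRoot s x n ^ s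
gcdₛ≡gcdRoot^s {s} {n} x s≢0 n≢0 = ≤-antisym (maxList≤ _ candidate≤) (∈⇒≤maxList _ D^s∈)
  where
  open GcdRoot s x n n≢0
  D : ℕ
  D = gcdRoot s x n
  C? : Decidable (λ l → l ^ s ∣ x × l ^ s ∣ n ^ s)
  C? l = (l ^ s ∣? x) ×-dec (l ^ s ∣? n ^ s)
  candidate≤ : ∀ {y} → y ∈ map (_^ s) (filter C? (range1 (x + n ^ s))) → y ≤ D ^ s
  candidate≤ y∈ with ∈-map⁻ (_^ s) y∈
  ... | l , l∈ , refl with proj₂ (∈-filter⁻ C? {xs = range1 (x + n ^ s)} l∈)
  ...   | lˢ∣x , lˢ∣nˢ = ^-monoˡ-≤ s (gcdRoot-max (m^s∣n^s⇒m∣n s≢0 lˢ∣nˢ) lˢ∣x)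
  D≤ : D ≤ x + n ^ s
  D≤ = ≤-trans (∣⇒≤ {{≢-nonZero n≢0}} (proj₁ gcdRoot∣)) (≤-trans (m≤m^n n s≢0) (m≤n+m (n ^ s) x))
  D^s∈ : D ^ s ∈ map (_^ s) (filter C? (range1 (x + n ^ s)))
  D^s∈ = ∈-map⁺ (_^ s) (∈-filter⁺ C? (∈-range1 (n≢0⇒n>0 gcdRoot≢0) D≤)
                                      (proj₂ gcdRoot∣ , ^-monoˡ-∣ s (proj₁ gcdRoot∣)))

Coprimeₛ : ℕ → ℕ → ℕ → Set
Coprimeₛ s c a = ∀ {f} → f ∣ a → f ^ s ∣ c → f ≡ 1

χ : ℕ → ℕ → ℕ → ℕ
χ s a c = 𝟙 (gcdₛ s c (a ^ s) ≟ 1)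

Φ≡∑χ : ∀ s a → Φ s (a ^ s) ≡ ∑[ i < a ^ s ] χ s a (suc i)
Φ≡∑χ s a = length-filter-applyUpTo (λ k → gcdₛ s k (a ^ s) ≟ 1) suc (a ^ s)

module _ {s a : ℕ} (s≢0 : s ≢ 0) (a≢0 : a ≢ 0) where

  gcdₛ≡1⇒Coprimeₛ : ∀ {c} → gcdₛ s c (a ^ s) ≡ 1 → Coprimeₛ s c a
  gcdₛ≡1⇒Coprimeₛ {c} g≡1 {f} f∣a fˢ∣c
    with m^n≡1⇒n≡0∨m≡1 (gcdRoot s c a) s (trans (sym (gcdₛ≡gcdRoot^s c s≢0 a≢0)) g≡1)
  ... | inj₁ s≡0 = ⊥-elim (s≢0 s≡0)
  ... | inj₂ D≡1 = ∣1⇒≡1 (subst (f ∣_) D≡1 (GcdRoot.gcdRoot-greatest s c a a≢0 f∣a fˢ∣c))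

  Coprimeₛ⇒gcdₛ≡1 : ∀ {c} → Coprimeₛ s c a → gcdₛ s c (a ^ s) ≡ 1
  Coprimeₛ⇒gcdₛ≡1 {c} cop = begin
    gcdₛ s c (a ^ s)    ≡⟨ gcdₛ≡gcdRoot^s c s≢0 a≢0 ⟩
    gcdRoot s c a ^ s   ≡⟨ cong (_^ s) (cop (proj₁ gcdRoot∣) (proj₂ gcdRoot∣)) ⟩
    1 ^ s               ≡⟨ ^-zeroˡ s ⟩
    1                   ∎
    where
    open ≡-Reasoning
    open GcdRoot s c a a≢0

  χ≡𝟙 : ∀ {b} {B : Set b} {c} → (Coprimeₛ s c a → B) → (B → Coprimeₛ s c a) →
        (B? : Dec B) → χ s a c ≡ 𝟙 B?
  χ≡𝟙 {c = c} to from B? = 𝟙-cong (λ g≡1 → to (gcdₛ≡1⇒Coprimeₛ g≡1)) (λ b → Coprimeₛ⇒gcdₛ≡1 (from b))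
                                   (gcdₛ s c (a ^ s) ≟ 1) B?

  χ-cong : ∀ {c c′} → (Coprimeₛ s c a → Coprimeₛ s c′ a) → (Coprimeₛ s c′ a → Coprimeₛ s c a) →
           χ s a c ≡ χ s a c′
  χ-cong {c′ = c′} to from = χ≡𝟙 (λ cop → Coprimeₛ⇒gcdₛ≡1 (to cop)) (λ g≡1 → from (gcdₛ≡1⇒Coprimeₛ g≡1))
                                 (gcdₛ s c′ (a ^ s) ≟ 1)

  χ-periodic : ∀ c {w} → a ^ s ∣ w → χ s a (c + w) ≡ χ s a c
  χ-periodic c {w} aˢ∣w = χ-cong
    (λ cop f∣a fˢ∣c → cop f∣a (∣m∣n⇒∣m+n fˢ∣c (fˢ∣w f∣a)))
    (λ cop {f} f∣a fˢ∣c+w →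
       cop f∣a (∣m+n∣m⇒∣n (subst (f ^ s ∣_) (+-comm c w) fˢ∣c+w) (fˢ∣w f∣a)))
    where
    fˢ∣w : ∀ {f} → f ∣ a → f ^ s ∣ w
    fˢ∣w f∣a = ∣-trans (^-monoˡ-∣ s f∣a) aˢ∣w

  χ[1]≡1 : χ s a 1 ≡ 1
  χ[1]≡1 = 𝟙-yes (gcdₛ s 1 (a ^ s) ≟ 1) (Coprimeₛ⇒gcdₛ≡1 fˢ∣1⇒f≡1)
    where
    fˢ∣1⇒f≡1 : Coprimeₛ s 1 a
    fˢ∣1⇒f≡1 {f} _ fˢ∣1 with m^n≡1⇒n≡0∨m≡1 f s (∣1⇒≡1 fˢ∣1)
    ... | inj₁ s≡0 = ⊥-elim (s≢0 s≡0)
    ... | inj₂ f≡1 = f≡1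

module _ {s c e : ℕ} (c≢0 : c ≢ 0) (e≢0 : e ≢ 0) where

  private
    ce≢0 : c * e ≢ 0
    ce≢0 ce≡0 = [ c≢0 , e≢0 ] (m*n≡0⇒m≡0∨n≡0 c ce≡0)
    instance
      c-nonZero : NonZero c
      c-nonZero = ≢-nonZero c≢0
      cˢ-nonZero : NonZero (c ^ s)
      cˢ-nonZero = m^n≢0 c s

  Coprimeₛ⇒gcdRoot≡ : ∀ {t} → Coprimeₛ s t e → gcdRoot s (t * c ^ s) (c * e) ≡ c
  Coprimeₛ⇒gcdRoot≡ {t} cop = begin
    D          ≡⟨ D≡u*c ⟩
    u * c      ≡⟨ cong (_* c) (cop u∣e uˢ∣t) ⟩
    1 * c      ≡⟨ *-identityˡ c ⟩
    c          ∎
    where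
    open ≡-Reasoning
    open GcdRoot s (t * c ^ s) (c * e) ce≢0
    D : ℕ
    D = gcdRoot s (t * c ^ s) (c * e)
    c∣D : c ∣ D
    c∣D = gcdRoot-greatest (m∣m*n e) (n∣m*n t)
    u : ℕ
    u = quotient c∣D
    D≡u*c : D ≡ u * c
    D≡u*c = _∣_.equality c∣D
    u∣e : u ∣ e
    u∣e = *-cancelʳ-∣ c (subst₂ _∣_ D≡u*c (*-comm c e) (proj₁ gcdRoot∣))
    uˢ∣t : u ^ s ∣ t
    uˢ∣t = *-cancelʳ-∣ (c ^ s)
      (subst (_∣ t * c ^ s) (trans (cong (_^ s) D≡u*c) (^-distribʳ-* s u c)) (proj₂ gcdRoot∣))

  gcdRoot≡⇒Coprimeₛ : ∀ {t} → gcdRoot s (t * c ^ s) (c * e) ≡ c → Coprimeₛ s t e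
  gcdRoot≡⇒Coprimeₛ {t} D≡c {f} f∣e fˢ∣t = ∣1⇒≡1 (*-cancelʳ-∣ c (subst (f * c ∣_) D≡1*c fc∣D))
    where
    open GcdRoot s (t * c ^ s) (c * e) ce≢0
    D≡1*c : gcdRoot s (t * c ^ s) (c * e) ≡ 1 * c
    D≡1*c = trans D≡c (sym (*-identityˡ c))
    fc∣D : f * c ∣ gcdRoot s (t * c ^ s) (c * e)
    fc∣D = gcdRoot-greatest (subst (f * c ∣_) (*-comm e c) (*-monoˡ-∣ c f∣e))
                            (subst (_∣ t * c ^ s) (sym (^-distribʳ-* s f c)) (*-monoˡ-∣ (c ^ s) fˢ∣t))

  ∑-gcdRoot-block : s ≢ 0 → ∀ t →
    ∑[ b < c ^ s ] 𝟙 (gcdRoot s (b + t * c ^ s) (c * e) * e ≟ c * e) ≡ χ s e t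
  ∑-gcdRoot-block s≢0 t = begin
    ∑[ b < c ^ s ] 𝟙 (gcdRoot s (b + t * c ^ s) (c * e) * e ≟ c * e)
      ≡⟨ ∑-head (c ^ s) _ (≢-nonZero⁻¹ (c ^ s)) off-block ⟩
    𝟙 (gcdRoot s (t * c ^ s) (c * e) * e ≟ c * e)
      ≡⟨ sym (χ≡𝟙 s≢0 e≢0 {c = t} (λ cop → cong (_* e) (Coprimeₛ⇒gcdRoot≡ cop))
                          (λ eq → gcdRoot≡⇒Coprimeₛ (*-cancelʳ-≡ _ _ e {{≢-nonZero e≢0}} eq)) _) ⟩
    χ s e t ∎
    where
    open ≡-Reasoning
    off-block : ∀ b → 0 < b → b < c ^ s → 𝟙 (gcdRoot s (b + t * c ^ s) (c * e) * e ≟ c * e) ≡ 0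
    off-block b 0<b b<cˢ = 𝟙-no (_ ≟ _) λ eq →
      ∤-progression t 0<b b<cˢ (subst (λ D → D ^ s ∣ b + t * c ^ s) (*-cancelʳ-≡ _ _ e {{≢-nonZero e≢0}} eq)
                                      (proj₂ (GcdRoot.gcdRoot∣ s _ (c * e) ce≢0)))

∑-gcdRoot-cofactor : ∀ {s D e} → s ≢ 0 → D ≢ 0 → e ∣ D →
                     ∑[ k < D ^ s ] 𝟙 (gcdRoot s k D * e ≟ D) ≡ Φ s (e ^ s)
∑-gcdRoot-cofactor {s} {_} {e} s≢0 ce≢0 (divides c refl) = begin
  ∑< ((c * e) ^ s) f
    ≡⟨ cong (λ K → ∑< K f) (trans (^-distribʳ-* s c e) (*-comm (c ^ s) _)) ⟩
  ∑< (e ^ s * c ^ s) f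
    ≡⟨ ∑-blocks (e ^ s) (c ^ s) f ⟩
  ∑[ t < e ^ s ] ∑[ b < c ^ s ] f (b + t * c ^ s)
    ≡⟨ ∑-cong (e ^ s) (λ t _ → ∑-gcdRoot-block {s = s} c≢0 e≢0 s≢0 t) ⟩
  ∑[ t < e ^ s ] χ s e t
    ≡⟨ sym (∑-rotate (e ^ s) (χ s e) (λ i → χ-periodic s≢0 e≢0 i ∣-refl) 1) ⟩
  ∑[ t < e ^ s ] χ s e (t + 1)
    ≡⟨ ∑-cong (e ^ s) (λ t _ → cong (χ s e) (+-comm t 1)) ⟩
  ∑[ t < e ^ s ] χ s e (suc t)
    ≡⟨ sym (Φ≡∑χ s e) ⟩
  Φ s (e ^ s) ∎
  where
  open ≡-Reasoning
  f : ℕ → ℕ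
  f k = 𝟙 (gcdRoot s k (c * e) * e ≟ c * e)
  c≢0 : c ≢ 0
  c≢0 c≡0 = ce≢0 (cong (_* e) c≡0)
  e≢0 : e ≢ 0
  e≢0 e≡0 = ce≢0 (trans (cong (c *_) e≡0) (*-zeroʳ c))

∑-cofactor≡1 : ∀ {d D} → D ≢ 0 → d ∣ D → ∑[ j < D ] 𝟙 ((suc j ∣? D) ×-dec (d * suc j ≟ D)) ≡ 1
∑-cofactor≡1 {d} qd≢0 (divides q refl) = trans
  (∑-cong (q * d) (λ j _ → 𝟙-cong to from ((suc j ∣? q * d) ×-dec (d * suc j ≟ q * d)) (j ≟ pred q)))
  (∑-δ pred[q]<qd)
  where
  instance
    q-nonZero : NonZero q
    q-nonZero = ≢-nonZero (λ q≡0 → qd≢0 (cong (_* d) q≡0))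
    d-nonZero : NonZero d
    d-nonZero = ≢-nonZero (λ d≡0 → qd≢0 (trans (cong (q *_) d≡0) (*-zeroʳ q)))
  pred[q]<qd : pred q < q * d
  pred[q]<qd = ≤-trans (≤-reflexive (suc-pred q)) (m≤m*n q d)
  to : ∀ {j} → suc j ∣ q * d × d * suc j ≡ q * d → j ≡ pred q
  to (_ , eq) = cong pred (*-cancelˡ-≡ _ _ d (trans eq (*-comm q d)))
  from : ∀ {j} → j ≡ pred q → suc j ∣ q * d × d * suc j ≡ q * d
  from refl = subst (_∣ q * d) (sym (suc-pred q)) (m∣m*n d)
            , trans (cong (d *_) (suc-pred q)) (*-comm d q)

pow≡∑Φ : ∀ {s D} → s ≢ 0 → D ≢ 0 → D ^ s ≡ ∑[ j < D ] (𝟙 (suc j ∣? D) * Φ s (suc j ^ s))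
pow≡∑Φ {s} {D} s≢0 D≢0 = begin
  D ^ s
    ≡⟨ sym (trans (∑-const (D ^ s) 1) (*-identityʳ _)) ⟩
  ∑[ _ < D ^ s ] 1
    ≡⟨ ∑-cong (D ^ s) (λ k _ → sym (∑-cofactor≡1 D≢0 (proj₁ (GcdRoot.gcdRoot∣ s k D D≢0)))) ⟩
  ∑[ k < D ^ s ] ∑[ j < D ] 𝟙 ((suc j ∣? D) ×-dec (gcdRoot s k D * suc j ≟ D))
    ≡⟨ ∑-comm (D ^ s) D _ ⟩
  ∑[ j < D ] ∑[ k < D ^ s ] 𝟙 ((suc j ∣? D) ×-dec (gcdRoot s k D * suc j ≟ D))
    ≡⟨ ∑-cong D (λ j _ → divisor-term j) ⟩
  ∑[ j < D ] (𝟙 (suc j ∣? D) * Φ s (suc j ^ s)) ∎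
  where
  open ≡-Reasoning
  restrict : ∀ {j} (j+1∣?D : Dec (suc j ∣ D)) →
    𝟙 j+1∣?D * ∑[ k < D ^ s ] 𝟙 (gcdRoot s k D * suc j ≟ D) ≡ 𝟙 j+1∣?D * Φ s (suc j ^ s)
  restrict (yes j+1∣D) = cong (1 *_) (∑-gcdRoot-cofactor s≢0 D≢0 j+1∣D)
  restrict (no _)      = refl
  divisor-term : ∀ j → ∑[ k < D ^ s ] 𝟙 ((suc j ∣? D) ×-dec (gcdRoot s k D * suc j ≟ D))
                     ≡ 𝟙 (suc j ∣? D) * Φ s (suc j ^ s)
  divisor-term j = begin
    ∑[ k < D ^ s ] 𝟙 ((suc j ∣? D) ×-dec (gcdRoot s k D * suc j ≟ D))
      ≡⟨ ∑-cong (D ^ s) (λ k _ → 𝟙-× (suc j ∣? D) (gcdRoot s k D * suc j ≟ D)) ⟩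
    ∑[ k < D ^ s ] (𝟙 (suc j ∣? D) * 𝟙 (gcdRoot s k D * suc j ≟ D))
      ≡⟨ sym (*-distribˡ-∑ (D ^ s) (𝟙 (suc j ∣? D)) (λ k → 𝟙 (gcdRoot s k D * suc j ≟ D))) ⟩
    𝟙 (suc j ∣? D) * ∑[ k < D ^ s ] 𝟙 (gcdRoot s k D * suc j ≟ D)
      ≡⟨ restrict (suc j ∣? D) ⟩
    𝟙 (suc j ∣? D) * Φ s (suc j ^ s) ∎

-- part is the largest divisor of n coprime to e.
record CoprimePart (e n : ℕ) : Set where
  field
    part    : ℕ
    part∣n  : part ∣ n
    coprime : Coprime e part
    maximal : ∀ {f} → f ∣ n → Coprime f part → Coprime f e → f ≡ 1

coprimePart : ∀ e {n} → n ≢ 0 → CoprimePart e n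
coprimePart e {n} n≢0 = go (suc n) ≤-refl n≢0
  where
  go : ∀ k {n} → n < k → n ≢ 0 → CoprimePart e n
  go zero () _
  go (suc k) {n} n<1+k n≢0 with gcd n e ≟ 1
  ... | yes g≡1 = record
    { part    = n
    ; part∣n  = ∣-refl
    ; coprime = coprime-sym (gcd≡1⇒coprime g≡1)
    ; maximal = λ f∣n cop[f,n] _ → cop[f,n] (∣-refl , f∣n)
    }
  ... | no g≢1 = record
    { part    = part
    ; part∣n  = ∣-trans part∣n (quotient-∣ g∣n)
    ; coprime = coprime
    ; maximal = λ f∣n cop[f,p] cop[f,e] → maximal (f∣n′ f∣n cop[f,e]) cop[f,p] cop[f,e]
    }
    where
    g∣n : gcd n e ∣ n
    g∣n = gcd[m,n]∣m n e
    n′ : ℕ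
    n′ = quotient g∣n
    g≢0 : gcd n e ≢ 0
    g≢0 = gcd[m,n]≢0 n e (inj₁ n≢0)
    n′≢0 : n′ ≢ 0
    n′≢0 = ∣-≢0 (quotient-∣ g∣n) n≢0
    n′<n : n′ < n
    n′<n = begin-strict
      n′              ≡⟨ sym (*-identityʳ n′) ⟩
      n′ * 1          <⟨ *-monoʳ-< n′ {{≢-nonZero n′≢0}} 1<g ⟩
      n′ * gcd n e    ≡⟨ sym (_∣_.equality g∣n) ⟩
      n               ∎
      where
      open ≤-Reasoning
      1<g : 1 < gcd n e
      1<g = ≤∧≢⇒< (n≢0⇒n>0 g≢0) (λ 1≡g → g≢1 (sym 1≡g))
    f∣n′ : ∀ {f} → f ∣ n → Coprime f e → f ∣ n′
    f∣n′ f∣n cop[f,e] = coprime-divisor (λ (d∣f , d∣g) → cop[f,e] (d∣f , ∣-trans d∣g (gcd[m,n]∣n n e)))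
                                        (subst (_ ∣_) (trans (_∣_.equality g∣n) (*-comm n′ _)) f∣n)
    open CoprimePart (go k (<-≤-trans n′<n (s≤s⁻¹ n<1+k)) n′≢0)

Coprimeₛ⇒coprime : ∀ {s c a f} → Coprimeₛ s c a → f ^ s ∣ c → Coprime f a
Coprimeₛ⇒coprime {s} {c} {a} {f} cop fˢ∣c =
  gcd≡1⇒coprime (cop (gcd[m,n]∣n f a) (∣-trans (^-monoˡ-∣ s (gcd[m,n]∣m f a)) fˢ∣c))

χ-split : ∀ {s e n} → s ≢ 0 → n ≢ 0 → e ∣ n → (P : CoprimePart e n) →
          ∀ c → χ s n c ≡ χ s e c * χ s (CoprimePart.part P) c
χ-split {s} {e} {n} s≢0 n≢0 e∣n P c =
  trans (χ≡𝟙 s≢0 n≢0 split join ((gcdₛ s c (e ^ s) ≟ 1) ×-dec (gcdₛ s c (part ^ s) ≟ 1)))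
        (𝟙-× (gcdₛ s c (e ^ s) ≟ 1) (gcdₛ s c (part ^ s) ≟ 1))
  where
  open CoprimePart P
  e≢0 : e ≢ 0
  e≢0 = ∣-≢0 e∣n n≢0
  part≢0 : part ≢ 0
  part≢0 = ∣-≢0 part∣n n≢0
  split : Coprimeₛ s c n → gcdₛ s c (e ^ s) ≡ 1 × gcdₛ s c (part ^ s) ≡ 1
  split cop = Coprimeₛ⇒gcdₛ≡1 s≢0 e≢0 (λ f∣e → cop (∣-trans f∣e e∣n))
            , Coprimeₛ⇒gcdₛ≡1 s≢0 part≢0 (λ f∣part → cop (∣-trans f∣part part∣n))
  join : gcdₛ s c (e ^ s) ≡ 1 × gcdₛ s c (part ^ s) ≡ 1 → Coprimeₛ s c n
  join (g₁ , g₂) f∣n fˢ∣c =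
    maximal f∣n (Coprimeₛ⇒coprime {s = s} (gcdₛ≡1⇒Coprimeₛ s≢0 part≢0 g₂) fˢ∣c)
                (Coprimeₛ⇒coprime {s = s} (gcdₛ≡1⇒Coprimeₛ s≢0 e≢0 g₁) fˢ∣c)

-- Shifting t by a Bézout coefficient x (x * m ≡ ±1 modulo K) moves c by one,
-- and t ↦ f (c + t * m) has period M.
∑-progression-invariant : ∀ {K m} M (f : ℕ → ℕ) → (∀ c {w} → K ∣ w → f (c + w) ≡ f c) →
                          K ∣ M * m → Coprime m K → ∀ c → ∑[ t < M ] f (c + t * m) ≡ ∑[ t < M ] f (t * m)
∑-progression-invariant {K} {m} M f periodic K∣Mm cop = invariant
  where
  H : ℕ → ℕ
  H c = ∑[ t < M ] f (c + t * m)
  rotate : ∀ c x → ∑[ t < M ] f (c + (t + x) * m) ≡ H c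
  rotate c = ∑-rotate M (λ t → f (c + t * m))
    (λ t → trans (cong f (c+[t+M]m≡c+tm+Mm c t M m)) (periodic (c + t * m) K∣Mm))
    where
    c+[t+M]m≡c+tm+Mm : ∀ c t M m → c + (t + M) * m ≡ c + t * m + M * m
    c+[t+M]m≡c+tm+Mm = solve-∀
  step : ∀ c → H (suc c) ≡ H c
  step c with coprime-Bézout cop
  ... | Bézout.+- x y 1+yK≡xm = trans (∑-cong M (λ t _ → sym (shift t))) (rotate c x)
    where
    shift : ∀ t → f (c + (t + x) * m) ≡ f (suc c + t * m)
    shift t = trans (cong f (begin
      c + (t + x) * m         ≡⟨ c+[t+x]m≡c+tm+xm c t x m ⟩
      c + t * m + x * m       ≡⟨ cong (c + t * m +_) (sym 1+yK≡xm) ⟩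
      c + t * m + (1 + y * K) ≡⟨ c+tm+[1+z]≡1+c+tm+z c (t * m) (y * K) ⟩
      suc c + t * m + y * K   ∎))
      (periodic (suc c + t * m) (n∣m*n y))
      where
      open ≡-Reasoning
      c+[t+x]m≡c+tm+xm : ∀ c t x m → c + (t + x) * m ≡ c + t * m + x * m
      c+[t+x]m≡c+tm+xm = solve-∀
      c+tm+[1+z]≡1+c+tm+z : ∀ c tm z → c + tm + (1 + z) ≡ suc c + tm + z
      c+tm+[1+z]≡1+c+tm+z = solve-∀
  ... | Bézout.-+ x y 1+xm≡yK = sym (trans (∑-cong M (λ t _ → sym (shift t))) (rotate (suc c) x))
    where
    shift : ∀ t → f (suc c + (t + x) * m) ≡ f (c + t * m)
    shift t = trans (cong f (trans (1+c+[t+x]m≡c+tm+[1+xm] c t x m) (cong (c + t * m +_) 1+xm≡yK)))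
                      (periodic (c + t * m) (n∣m*n y))
      where
      1+c+[t+x]m≡c+tm+[1+xm] : ∀ c t x m → suc c + (t + x) * m ≡ c + t * m + (1 + x * m)
      1+c+[t+x]m≡c+tm+[1+xm] = solve-∀
  invariant : ∀ c → H c ≡ H 0
  invariant zero    = refl
  invariant (suc c) = trans (step c) (invariant c)

module Fiber {s n e : ℕ} (s≢0 : s ≢ 0) (n≢0 : n ≢ 0) (e∣n : e ∣ n) where

  private
    P : CoprimePart e n
    P = coprimePart e n≢0
    open CoprimePart P
    e≢0 : e ≢ 0
    e≢0 = ∣-≢0 e∣n n≢0
    part≢0 : part ≢ 0
    part≢0 = ∣-≢0 part∣n n≢0
    m M : ℕ
    m = e ^ s
    M = quotient e∣n ^ s
    nˢ≡Mm : n ^ s ≡ M * m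
    nˢ≡Mm = trans (cong (_^ s) (_∣_.equality e∣n)) (^-distribʳ-* s (quotient e∣n) e)

    H : ℕ → ℕ
    H c = ∑[ t < M ] χ s part (c + t * m)

    H-invariant : ∀ c → H c ≡ H 0
    H-invariant = ∑-progression-invariant M (χ s part) (χ-periodic s≢0 part≢0)
      (subst (part ^ s ∣_) nˢ≡Mm (^-monoˡ-∣ s part∣n)) (coprime-^ s coprime)

    column : ∀ b → ∑[ t < M ] χ s n (suc b + t * m) ≡ χ s e (suc b) * H 0
    column b = begin
      ∑[ t < M ] χ s n (suc b + t * m)
        ≡⟨ ∑-cong M (λ t _ → trans (χ-split s≢0 n≢0 e∣n P (suc b + t * m))
                                   (cong (_* χ s part (suc b + t * m)) (χ-periodic s≢0 e≢0 (suc b) (n∣m*n t)))) ⟩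
      ∑[ t < M ] (χ s e (suc b) * χ s part (suc b + t * m))
        ≡⟨ sym (*-distribˡ-∑ M (χ s e (suc b)) (λ t → χ s part (suc b + t * m))) ⟩
      χ s e (suc b) * H (suc b)
        ≡⟨ cong (χ s e (suc b) *_) (H-invariant (suc b)) ⟩
      χ s e (suc b) * H 0 ∎
      where open ≡-Reasoning

    Φ≡Φ*H : Φ s (n ^ s) ≡ Φ s m * H 0
    Φ≡Φ*H = begin
      Φ s (n ^ s)                                   ≡⟨ Φ≡∑χ s n ⟩
      ∑[ i < n ^ s ] χ s n (suc i)                  ≡⟨ cong (λ K → ∑[ i < K ] χ s n (suc i)) nˢ≡Mm ⟩
      ∑[ i < M * m ] χ s n (suc i)                  ≡⟨ ∑-blocks M m _ ⟩
      ∑[ t < M ] ∑[ b < m ] χ s n (suc b + t * m)   ≡⟨ ∑-comm M m _ ⟩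
      ∑[ b < m ] ∑[ t < M ] χ s n (suc b + t * m)   ≡⟨ ∑-cong m (λ b _ → column b) ⟩
      ∑[ b < m ] (χ s e (suc b) * H 0)              ≡⟨ sym (*-distribʳ-∑ m (H 0) (λ b → χ s e (suc b))) ⟩
      (∑[ b < m ] χ s e (suc b)) * H 0              ≡⟨ cong (_* H 0) (sym (Φ≡∑χ s e)) ⟩
      Φ s m * H 0                                   ∎
      where open ≡-Reasoning

    ∑-fiber≡H : ∑[ i < n ^ s ] (χ s n (suc i) * 𝟙 (m ∣? i)) ≡ H 0
    ∑-fiber≡H = begin
      ∑[ i < n ^ s ] F i                    ≡⟨ cong (λ K → ∑< K F) nˢ≡Mm ⟩
      ∑[ i < M * m ] F i                    ≡⟨ ∑-blocks M m F ⟩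
      ∑[ t < M ] ∑[ b < m ] F (b + t * m)   ≡⟨ ∑-cong M (λ t _ → ∑-head m _ m≢0 (off-fiber t)) ⟩
      ∑[ t < M ] F (t * m)                  ≡⟨ ∑-cong M (λ t _ → on-fiber t) ⟩
      H 1                                   ≡⟨ H-invariant 1 ⟩
      H 0                                   ∎
      where
      open ≡-Reasoning
      F : ℕ → ℕ
      F i = χ s n (suc i) * 𝟙 (m ∣? i)
      m≢0 : m ≢ 0
      m≢0 m≡0 = e≢0 (m^n≡0⇒m≡0 e s m≡0)
      off-fiber : ∀ t b → 0 < b → b < m → F (b + t * m) ≡ 0
      off-fiber t b 0<b b<m =
        trans (cong (χ s n (suc (b + t * m)) *_) (𝟙-no (m ∣? b + t * m) (∤-progression t 0<b b<m)))
              (*-zeroʳ (χ s n (suc (b + t * m))))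
      on-fiber : ∀ t → F (t * m) ≡ χ s part (1 + t * m)
      on-fiber t = begin
        χ s n (1 + t * m) * 𝟙 (m ∣? t * m)
          ≡⟨ cong₂ _*_ (χ-split s≢0 n≢0 e∣n P (1 + t * m)) (𝟙-yes (m ∣? t * m) (n∣m*n t)) ⟩
        χ s e (1 + t * m) * χ s part (1 + t * m) * 1
          ≡⟨ cong (λ x → x * χ s part (1 + t * m) * 1)
                  (trans (χ-periodic s≢0 e≢0 1 (n∣m*n t)) (χ[1]≡1 s≢0 e≢0)) ⟩
        1 * χ s part (1 + t * m) * 1
          ≡⟨ trans (*-identityʳ _) (*-identityˡ _) ⟩
        χ s part (1 + t * m) ∎

  Φ*∑-fiber : Φ s (e ^ s) * ∑[ i < n ^ s ] (χ s n (suc i) * 𝟙 (e ^ s ∣? i)) ≡ Φ s (n ^ s)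
  Φ*∑-fiber = trans (cong (Φ s m *_) ∑-fiber≡H) (sym Φ≡Φ*H)

gcdₛ≡∑Φ : ∀ {s n} i → s ≢ 0 → n ≢ 0 →
  gcdₛ s i (n ^ s) ≡ ∑[ j < n ] (𝟙 ((suc j ∣? n) ×-dec (suc j ^ s ∣? i)) * Φ s (suc j ^ s))
gcdₛ≡∑Φ {s} {n} i s≢0 n≢0 = begin
  gcdₛ s i (n ^ s)
    ≡⟨ gcdₛ≡gcdRoot^s i s≢0 n≢0 ⟩
  D ^ s
    ≡⟨ pow≡∑Φ s≢0 D≢0 ⟩
  ∑[ j < D ] (𝟙 (suc j ∣? D) * Φ s (suc j ^ s))
    ≡⟨ sym (∑-truncate _ (∣⇒≤ {{≢-nonZero n≢0}} D∣n) beyond-D) ⟩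
  ∑[ j < n ] (𝟙 (suc j ∣? D) * Φ s (suc j ^ s))
    ≡⟨ ∑-cong n (λ j _ → cong (_* Φ s (suc j ^ s)) (𝟙-cong (to j) (from j) (suc j ∣? D) (A? j))) ⟩
  ∑[ j < n ] (𝟙 (A? j) * Φ s (suc j ^ s)) ∎
  where
  open ≡-Reasoning
  A? : ∀ j → Dec (suc j ∣ n × suc j ^ s ∣ i)
  A? j = (suc j ∣? n) ×-dec (suc j ^ s ∣? i)
  open GcdRoot s i n n≢0
  D : ℕ
  D = gcdRoot s i n
  D∣n : D ∣ n
  D∣n = proj₁ gcdRoot∣
  Dˢ∣i : D ^ s ∣ i
  Dˢ∣i = proj₂ gcdRoot∣
  D≢0 : D ≢ 0
  D≢0 = ∣-≢0 D∣n n≢0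
  to : ∀ j → suc j ∣ D → suc j ∣ n × suc j ^ s ∣ i
  to j j+1∣D = ∣-trans j+1∣D D∣n , ∣-trans (^-monoˡ-∣ s j+1∣D) Dˢ∣i
  from : ∀ j → suc j ∣ n × suc j ^ s ∣ i → suc j ∣ D
  from j (j+1∣n , j+1ˢ∣i) = gcdRoot-greatest j+1∣n j+1ˢ∣i
  beyond-D : ∀ j → 𝟙 (suc (D + j) ∣? D) * Φ s (suc (D + j) ^ s) ≡ 0
  beyond-D j = cong (_* Φ s (suc (D + j) ^ s)) (𝟙-no (suc (D + j) ∣? D) (1+m+n∤m j D≢0))

lhsSum≡∑Φ : ∀ {n s} → s ≢ 0 → n ≢ 0 → lhsSum n s ≡ ∑[ j < n ] (𝟙 (suc j ∣? n) * Φ s (n ^ s))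
lhsSum≡∑Φ {n} {s} s≢0 n≢0 = begin
  lhsSum n s
    ≡⟨ sum-map-filter-applyUpTo (λ a → gcdₛ s a N ≟ 1) (λ a → gcdₛ s (a ∸ 1) N) suc N ⟩
  ∑[ i < N ] (χ s n (suc i) * gcdₛ s i N)
    ≡⟨ ∑-cong N (λ i _ → trans (cong (χ s n (suc i) *_) (gcdₛ≡∑Φ i s≢0 n≢0))
                               (*-distribˡ-∑ n (χ s n (suc i)) (λ j → 𝟙 (A? j i) * Φ s (suc j ^ s)))) ⟩
  ∑[ i < N ] ∑[ j < n ] (χ s n (suc i) * (𝟙 (A? j i) * Φ s (suc j ^ s)))
    ≡⟨ ∑-comm N n _ ⟩
  ∑[ j < n ] ∑[ i < N ] (χ s n (suc i) * (𝟙 (A? j i) * Φ s (suc j ^ s)))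
    ≡⟨ ∑-cong n (λ j _ → divisor-term j) ⟩
  ∑[ j < n ] (𝟙 (suc j ∣? n) * Φ s N) ∎
  where
  open ≡-Reasoning
  N : ℕ
  N = n ^ s
  A? : ∀ j i → Dec (suc j ∣ n × suc j ^ s ∣ i)
  A? j i = (suc j ∣? n) ×-dec (suc j ^ s ∣? i)
  restrict : ∀ {j} (j+1∣?n : Dec (suc j ∣ n)) →
    𝟙 j+1∣?n * (Φ s (suc j ^ s) * ∑[ i < N ] (χ s n (suc i) * 𝟙 (suc j ^ s ∣? i))) ≡ 𝟙 j+1∣?n * Φ s N
  restrict (yes j+1∣n) = cong (1 *_) (Fiber.Φ*∑-fiber s≢0 n≢0 j+1∣n)
  restrict (no _)      = refl
  divisor-term : ∀ j → ∑[ i < N ] (χ s n (suc i) * (𝟙 (A? j i) * Φ s (suc j ^ s))) ≡ 𝟙 (suc j ∣? n) * Φ s N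
  divisor-term j = begin
    ∑[ i < N ] (χ s n (suc i) * (𝟙 (A? j i) * Φ s (suc j ^ s)))
      ≡⟨ ∑-cong N (λ i _ → regroup i) ⟩
    ∑[ i < N ] (a * (φ * (χ s n (suc i) * 𝟙 (suc j ^ s ∣? i))))
      ≡⟨ sym (trans (cong (a *_) (*-distribˡ-∑ N φ _)) (*-distribˡ-∑ N a _)) ⟩
    a * (φ * ∑[ i < N ] (χ s n (suc i) * 𝟙 (suc j ^ s ∣? i)))
      ≡⟨ restrict (suc j ∣? n) ⟩
    a * Φ s N ∎
    where
    a φ : ℕ
    a = 𝟙 (suc j ∣? n)
    φ = Φ s (suc j ^ s)
    x*[a*b*φ]≡a*[φ*[x*b]] : ∀ x a b φ → x * (a * b * φ) ≡ a * (φ * (x * b))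
    x*[a*b*φ]≡a*[φ*[x*b]] = solve-∀
    regroup : ∀ i → χ s n (suc i) * (𝟙 (A? j i) * φ) ≡ a * (φ * (χ s n (suc i) * 𝟙 (suc j ^ s ∣? i)))
    regroup i = trans (cong (λ y → χ s n (suc i) * (y * φ)) (𝟙-× (suc j ∣? n) (suc j ^ s ∣? i)))
                      (x*[a*b*φ]≡a*[φ*[x*b]] (χ s n (suc i)) a (𝟙 (suc j ^ s ∣? i)) φ)

τ≡∑𝟙 : ∀ {s n} → s ≢ 0 → n ≢ 0 → τ s (n ^ s) ≡ ∑[ j < n ] 𝟙 (suc j ∣? n)
τ≡∑𝟙 {s} {n} s≢0 n≢0 = begin
  τ s (n ^ s)
    ≡⟨ length-filter-applyUpTo (λ d → d ^ s ∣? n ^ s) suc (n ^ s) ⟩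
  ∑[ j < n ^ s ] 𝟙 (suc j ^ s ∣? n ^ s)
    ≡⟨ ∑-cong (n ^ s) (λ j _ → 𝟙-cong (m^s∣n^s⇒m∣n s≢0) (^-monoˡ-∣ s) (suc j ^ s ∣? n ^ s) (suc j ∣? n)) ⟩
  ∑[ j < n ^ s ] 𝟙 (suc j ∣? n)
    ≡⟨ ∑-truncate _ (m≤m^n n s≢0) beyond-n ⟩
  ∑[ j < n ] 𝟙 (suc j ∣? n) ∎
  where
  open ≡-Reasoning
  beyond-n : ∀ j → 𝟙 (suc (n + j) ∣? n) ≡ 0
  beyond-n j = 𝟙-no (suc (n + j) ∣? n) (1+m+n∤m j n≢0)

theorem3p4 : (n s : ℕ) → .{{_ : NonZero n}} → .{{_ : NonZero s}} →
    lhsSum n s ≡ Φ s (n ^ s) * τ s (n ^ s)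
theorem3p4 n s = begin
  lhsSum n s                                 ≡⟨ lhsSum≡∑Φ s≢0 n≢0 ⟩
  ∑[ j < n ] (𝟙 (suc j ∣? n) * Φ s (n ^ s))  ≡⟨ sym (*-distribʳ-∑ n (Φ s (n ^ s)) _) ⟩
  (∑[ j < n ] 𝟙 (suc j ∣? n)) * Φ s (n ^ s)  ≡⟨ cong (_* Φ s (n ^ s)) (sym (τ≡∑𝟙 s≢0 n≢0)) ⟩
  τ s (n ^ s) * Φ s (n ^ s)                  ≡⟨ *-comm (τ s (n ^ s)) (Φ s (n ^ s)) ⟩
  Φ s (n ^ s) * τ s (n ^ s)                  ∎
  where
  open ≡-Reasoning
  s≢0 : s ≢ 0
  s≢0 = ≢-nonZero⁻¹ s
  n≢0 : n ≢ 0
  n≢0 = ≢-nonZero⁻¹ n
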